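{- Let $H$ be any graph and $J$ any $(n,m)$-separable graph. If $G$ is any $n$-vertex graph contained in $H\boxtimes J$, then $G$ is contained in $L\boxtimes K_m$ for some graph $L$ with $\mathrm{tw}(L)\le\mathrm{tw}(H)+1$.
   Context: A graph $J$ is $(n,m)$-separable if for every assignment of non-negative real weights to the vertices of $J$ with total weight $n$, there is a set $S\subseteq V(J)$ of total weight at most $m$ such that each component of $J-S$ has at most $m$ vertices. $\mathrm{tw}$ denotes tree-width. The strong product $A\boxtimes B$ has vertex set $V(A)\times V(B)$, with distinct $(v,x),(w,y)$ adjacent iff ($v=w$ and $xy\in E(B)$) or ($x=y$ and $vw\in E(A)$) or ($vw\in E(A)$ and $xy\in E(B)$). Contained means isomorphic to a subgraph. -}

module Defs where

open import Level using (Level; 0ℓ)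
open import Data.Nat as ℕ using (ℕ; zero; suc)
open import Data.Fin using (Fin; zero; suc; toℕ; remQuot)
open import Data.Bool using (Bool; true; false; if_then_else_)
open import Data.Product using (Σ; ∃; _×_; _,_)
open import Data.Sum using (_⊎_)
open import Data.Integer using (+_)
open import Data.Rational as ℚ using (ℚ; 0ℚ)
open import Relation.Nullary using (¬_; Dec)
open import Relation.Binary.PropositionalEquality using (_≡_; _≢_)
open import Function.Definitions using (Injective)

record Graph : Set₁ where
  field
    size  : ℕ
    E     : Fin size → Fin size → Set
    E-dec : ∀ u v → Dec (E u v)
    E-sym : ∀ {u v} → E u v → E v u
    E-irr : ∀ {u} → ¬ E u u
open Graph public

K : ℕ → Graph
K m = record
  { size = m ; E = λ i j → i ≢ j
  ; E-dec = λ i j → Relation.Nullary.¬? (i Data.Fin.≟ j)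
  ; E-sym = λ p q → p (Relation.Binary.PropositionalEquality.sym q)
  ; E-irr = λ p → p Relation.Binary.PropositionalEquality.refl }
  where import Relation.Nullary ; import Data.Fin ; import Relation.Binary.PropositionalEquality

SE : (A B : Graph) → (Fin (size A) × Fin (size B)) → (Fin (size A) × Fin (size B)) → Set
SE A B (v , x) (w , y) =
  (v ≡ w × E B x y) ⊎ ((x ≡ y × E A v w) ⊎ (E A v w × E B x y))

-- Strong product; vertex (v , x) is encoded as combine v x : Fin (size A * size B)
_⊠_ : Graph → Graph → Graph
A ⊠ B = record
  { size = size A ℕ.* size B
  ; E = λ p q → SE A B (remQuot (size B) p) (remQuot (size B) q)
  ; E-dec = λ p q → dec (remQuot (size B) p) (remQuot (size B) q)
  ; E-sym = λ e → sym' (remQuot (size B) _) (remQuot (size B) _) e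
  ; E-irr = λ e → irr' (remQuot (size B) _) e }
  where
  open import Data.Sum using (inj₁; inj₂)
  open import Relation.Nullary using (yes; no)
  open import Relation.Nullary.Decidable using (_×-dec_; _⊎-dec_)
  open import Relation.Binary.PropositionalEquality using (sym; refl)
  import Data.Fin as F
  dec : ∀ a b → Dec (SE A B a b)
  dec (v , x) (w , y) =
    ((v F.≟ w) ×-dec E-dec B x y) ⊎-dec (((x F.≟ y) ×-dec E-dec A v w) ⊎-dec (E-dec A v w ×-dec E-dec B x y))
  sym' : ∀ a b → SE A B a b → SE A B b a
  sym' (v , x) (w , y) (inj₁ (p , e)) = inj₁ (sym p , E-sym B e)
  sym' (v , x) (w , y) (inj₂ (inj₁ (p , e))) = inj₂ (inj₁ (sym p , E-sym A e))
  sym' (v , x) (w , y) (inj₂ (inj₂ (e , f))) = inj₂ (inj₂ (E-sym A e , E-sym B f))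
  irr' : ∀ a → ¬ SE A B a a
  irr' (v , x) (inj₁ (_ , e)) = E-irr B e
  irr' (v , x) (inj₂ (inj₁ (_ , e))) = E-irr A e
  irr' (v , x) (inj₂ (inj₂ (e , _))) = E-irr A e

_⊆G_ : Graph → Graph → Set
G ⊆G H = Σ (Fin (size G) → Fin (size H)) λ f →
  Injective _≡_ _≡_ f × (∀ u v → E G u v → E H (f u) (f v))

sumℚ : ∀ {k} → (Fin k → ℚ) → ℚ
sumℚ {zero}  f = 0ℚ
sumℚ {suc k} f = f zero ℚ.+ sumℚ (λ i → f (suc i))

count : ∀ {k} → (Fin k → Bool) → ℕ
count {zero}  X = 0
count {suc k} X = (if X zero then 1 else 0) ℕ.+ count (λ i → X (suc i))

ℕtoℚ : ℕ → ℚ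
ℕtoℚ n = + n ℚ./ 1

data Reach {A : Set} (R : A → A → Set) (P : A → Set) : A → A → Set where
  here : ∀ {a} → P a → Reach R P a a
  step : ∀ {a b c} → P a → R a b → Reach R P b c → Reach R P a c

-- Every component of J - S has at most m vertices: for every vertex v
-- outside S, every set X of vertices reachable from v in J - S has |X| ≤ m.
SmallComponents : (J : Graph) → (Fin (size J) → Bool) → ℕ → Set
SmallComponents J S m =
  ∀ (v : Fin (size J)) (X : Fin (size J) → Bool) →
  (∀ x → X x ≡ true → Reach (E J) (λ y → S y ≡ false) v x) →
  count X ℕ.≤ m

Separable : Graph → ℕ → ℕ → Set
Separable J n m =
  ∀ (w : Fin (size J) → ℚ) →
  (∀ x → 0ℚ ℚ.≤ w x) →
  sumℚ w ≡ ℕtoℚ n →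
  Σ (Fin (size J) → Bool) λ S →
    (sumℚ (λ x → if S x then w x else 0ℚ) ℚ.≤ ℕtoℚ m) × SmallComponents J S m

-- A tree on nodes Fin t, presented by a parent function: every node i
-- other than node 0 has parent(i) with toℕ (parent i) < toℕ i.
-- (Every finite tree admits such a labelling, e.g. BFS order.)
record Tree (t : ℕ) : Set where
  field
    parent    : Fin t → Fin t
    parent-lt : ∀ i → toℕ i ≢ 0 → toℕ (parent i) ℕ.< toℕ i

TreeEdge : ∀ {t} → Tree t → Fin t → Fin t → Set
TreeEdge T i j =
  (toℕ j ≢ 0 × Tree.parent T j ≡ i) ⊎ (toℕ i ≢ 0 × Tree.parent T i ≡ j)

record TreeDecomposition (H : Graph) (w : ℕ) : Set where
  field
    t     : ℕ
    tree  : Tree t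
    bag   : Fin t → Fin (size H) → Bool
    cover-vertex : ∀ v → ∃ λ a → bag a v ≡ true
    cover-edge   : ∀ u v → E H u v → ∃ λ a → bag a u ≡ true × bag a v ≡ true
    connected    : ∀ v a b → bag a v ≡ true → bag b v ≡ true →
                   Reach (TreeEdge tree) (λ c → bag c v ≡ true) a b
    width-≤      : ∀ a → count (bag a) ℕ.≤ suc w

TwAtMost : Graph → ℕ → Set
TwAtMost H w = TreeDecomposition H w

-- Let f embed G in H ⊠ J and weight each vertex x of J by the number of vertices of G that f
-- places in the column H × {x}; the total weight is n.  Separability gives S ⊆ V(J) carrying
-- at most m vertices of G such that every component of J − S has at most m vertices.  Let L be
-- an apex joined to disjoint copies of H, one for each component of J − S.  Send a vertex of G
-- over S to the apex, and a vertex over (h , x) with x ∉ S to vertex h of the copy belonging to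
-- the component C of x; as K_m-coordinate take its rank among the vertices over S, resp. the
-- rank of x in C, which makes the map into L ⊠ K_m injective.  Edges survive because the
-- J-coordinates of adjacent vertices off S lie in one component.  Adding the apex to every bag
-- of disjoint copies of a tree decomposition of H shows tw(L) ≤ tw(H) + 1.
module Submission where

open import Defs
open import Data.Nat as ℕ using (ℕ; zero; suc; _+_; _≤_; _<_; z≤n; s≤s)
import Data.Nat.Properties as NP
open import Data.Fin using (Fin; zero; suc; toℕ; remQuot; combine; fromℕ<; _↑ˡ_; _↑ʳ_)
open import Data.Fin.Properties as FP using (_≟_)
open import Data.Bool using (Bool; true; false; if_then_else_; _∧_)
open import Data.Bool.Properties as Bool using (if-eta; if-float)
open import Data.Product using (Σ; ∃; _×_; _,_; proj₁; proj₂; uncurry)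
open import Data.Sum using (_⊎_; inj₁; inj₂)
open import Data.List using (List; []; _∷_; cartesianProduct; allFin)
open import Data.List.Membership.Propositional using (_∈_)
open import Data.List.Membership.Propositional.Properties using (∈-cartesianProduct⁺; ∈-allFin)
open import Data.List.Relation.Unary.Any using (here; there)
import Data.Integer as ℤ
import Data.Integer.Properties as ZP
open import Data.Rational as ℚ using (ℚ; 0ℚ)
import Data.Rational.Properties as QP
import Data.Rational.Unnormalised as ℚᵘ
import Data.Rational.Unnormalised.Properties as UP
open import Data.Empty using (⊥; ⊥-elim)
open import Data.Unit using (⊤; tt)
open import Function using (_∘_; id)
open import Function.Definitions using (Injective)
open import Relation.Nullary using (Dec; yes; no; does)
open import Relation.Nullary.Decidable using (_×-dec_; dec-true)
open import Relation.Binary.PropositionalEquality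
open import Algebra.Properties.CommutativeMonoid.Sum NP.+-0-commutativeMonoid
  using (sum; sum-cong-≗; ∑-distrib-+; sum-replicate-zero)

does-true⇒ : ∀ {A : Set} (a? : Dec A) → does a? ≡ true → A
does-true⇒ (yes a) _ = a
does-true⇒ (no _) ()

∧-true : ∀ {a b} → a ∧ b ≡ true → a ≡ true × b ≡ true
∧-true {true} b≡true = refl , b≡true

indicator : Bool → ℕ
indicator b = if b then 1 else 0

if-distrib-+ : ∀ b {m n} → (if b then m + n else 0) ≡ (if b then m else 0) + (if b then n else 0)
if-distrib-+ true  = refl
if-distrib-+ false = refl

sum-if-0 : ∀ {k} (P : Fin k → Bool) → sum (λ x → if P x then 0 else 0) ≡ 0
sum-if-0 {k} P = trans (sum-cong-≗ (λ x → if-eta (P x))) (sum-replicate-zero k)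

sum-if-≟ : ∀ {k} (P : Fin k → Bool) (y : Fin k) →
           sum (λ x → if P x then indicator (does (y ≟ x)) else 0) ≡ indicator (P y)
sum-if-≟ P zero    = trans (cong (indicator (P zero) +_) (sum-if-0 (P ∘ suc))) (NP.+-identityʳ _)
sum-if-≟ P (suc y) =
  trans (cong (_+ sum (λ x → if P (suc x) then indicator (does (y ≟ x)) else 0)) (if-eta (P zero)))
        (sum-if-≟ (P ∘ suc) y)

count-cong : ∀ {k} {X Y : Fin k → Bool} → X ≗ Y → count X ≡ count Y
count-cong {zero}  _   = refl
count-cong {suc k} X≗Y = cong₂ _+_ (cong indicator (X≗Y zero)) (count-cong (X≗Y ∘ suc))

count-true : ∀ k → count {k} (λ _ → true) ≡ k
count-true zero    = refl
count-true (suc k) = cong suc (count-true k)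

count-false : ∀ k → count {k} (λ _ → false) ≡ 0
count-false zero    = refl
count-false (suc k) = count-false k

count-split : ∀ a {b} (X : Fin (a + b) → Bool) →
              count X ≡ count (X ∘ (_↑ˡ b)) + count (X ∘ (a ↑ʳ_))
count-split zero    X = refl
count-split (suc a) X = trans (cong (indicator (X zero) +_) (count-split a (X ∘ suc)))
                              (sym (NP.+-assoc (indicator (X zero)) _ _))

fibre : ∀ {a b} → (Fin a → Fin b) → Fin b → ℕ
fibre g x = count (λ u → does (g u ≟ x))

count-∘ : ∀ {a b} (g : Fin a → Fin b) (P : Fin b → Bool) →
          count (P ∘ g) ≡ sum (λ x → if P x then fibre g x else 0)
count-∘ {zero}  g P = sym (sum-if-0 P)
count-∘ {suc a} {b} g P = sym (begin
  sum (λ x → if P x then indicator (does (g zero ≟ x)) + fibre (g ∘ suc) x else 0)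
    ≡⟨ sum-cong-≗ (λ x → if-distrib-+ (P x)) ⟩
  sum (λ x → first x + rest x)
    ≡⟨ ∑-distrib-+ first rest ⟩
  sum first + sum rest
    ≡⟨ cong₂ _+_ (sum-if-≟ P (g zero)) (sym (count-∘ (g ∘ suc) P)) ⟩
  indicator (P (g zero)) + count (P ∘ g ∘ suc) ∎)
  where
  open ≡-Reasoning
  first rest : Fin b → ℕ
  first x = if P x then indicator (does (g zero ≟ x)) else 0
  rest  x = if P x then fibre (g ∘ suc) x else 0

count-single : ∀ {b} (j : Fin b) (c : Bool) → count (λ x → does (j ≟ x) ∧ c) ≡ indicator c
count-single {suc b} zero c = trans (cong (indicator c +_) (count-false b)) (NP.+-identityʳ _)
count-single (suc j)    c = count-single j c

remQuot-↑ˡ : ∀ {a} b (x : Fin b) → remQuot {suc a} b (x ↑ˡ (a ℕ.* b)) ≡ (zero , x)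
remQuot-↑ˡ {a} b x = FP.remQuot-combine {suc a} {b} zero x

remQuot-↑ʳ : ∀ {a} b (y : Fin (a ℕ.* b)) →
             remQuot {suc a} b (b ↑ʳ y) ≡ (suc (proj₁ (remQuot {a} b y)) , proj₂ (remQuot {a} b y))
remQuot-↑ʳ {a} b y rewrite FP.splitAt-↑ʳ b (a ℕ.* b) y = refl

count-column : ∀ {a b} (B : Fin a → Bool) (j : Fin b) →
               count {a ℕ.* b} (λ q → does (j ≟ proj₂ (remQuot {a} b q)) ∧ B (proj₁ (remQuot {a} b q)))
               ≡ count B
count-column {zero}      B j = refl
count-column {suc a} {b} B j = begin
  count (λ q → inColumn (remQuot {suc a} b q))
    ≡⟨ count-split b (λ q → inColumn (remQuot {suc a} b q)) ⟩
  count (λ x → inColumn (remQuot {suc a} b (x ↑ˡ (a ℕ.* b))))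
    + count (λ y → inColumn (remQuot {suc a} b (b ↑ʳ y)))
    ≡⟨ cong₂ _+_ (count-cong (cong inColumn ∘ remQuot-↑ˡ {a} b))
                 (count-cong (cong inColumn ∘ remQuot-↑ʳ {a} b)) ⟩
  count (λ x → does (j ≟ x) ∧ B zero)
    + count (λ y → does (j ≟ proj₂ (remQuot {a} b y)) ∧ B (suc (proj₁ (remQuot {a} b y))))
    ≡⟨ cong₂ _+_ (count-single j (B zero)) (count-column (B ∘ suc) j) ⟩
  count B ∎
  where
  open ≡-Reasoning
  inColumn : Fin (suc a) × Fin b → Bool
  inColumn (i , j′) = does (j ≟ j′) ∧ B i

toℚᵘ-ℕtoℚ : ∀ n → ℚ.toℚᵘ (ℕtoℚ n) ℚᵘ.≃ ℚᵘ.mkℚᵘ (ℤ.+ n) 0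
toℚᵘ-ℕtoℚ n = QP.toℚᵘ-fromℚᵘ (ℚᵘ.mkℚᵘ (ℤ.+ n) 0)

mkℚᵘ-+ : ∀ a b → ℚᵘ.mkℚᵘ (ℤ.+ a) 0 ℚᵘ.+ ℚᵘ.mkℚᵘ (ℤ.+ b) 0 ℚᵘ.≃ ℚᵘ.mkℚᵘ (ℤ.+ (a + b)) 0
mkℚᵘ-+ a b = ℚᵘ.*≡* (begin
  (ℤ.+ a ℤ.* ℤ.+ 1 ℤ.+ ℤ.+ b ℤ.* ℤ.+ 1) ℤ.* ℤ.+ 1
    ≡⟨ ZP.*-identityʳ _ ⟩
  ℤ.+ a ℤ.* ℤ.+ 1 ℤ.+ ℤ.+ b ℤ.* ℤ.+ 1
    ≡⟨ cong₂ ℤ._+_ (ZP.*-identityʳ (ℤ.+ a)) (ZP.*-identityʳ (ℤ.+ b)) ⟩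
  ℤ.+ (a + b)
    ≡⟨ ZP.*-identityʳ _ ⟨
  ℤ.+ (a + b) ℤ.* ℤ.+ 1 ∎)
  where open ≡-Reasoning

ℕtoℚ-+ : ∀ a b → ℕtoℚ (a + b) ≡ ℕtoℚ a ℚ.+ ℕtoℚ b
ℕtoℚ-+ a b = QP.toℚᵘ-injective (begin
  ℚ.toℚᵘ (ℕtoℚ (a + b))                    ≈⟨ toℚᵘ-ℕtoℚ (a + b) ⟩
  ℚᵘ.mkℚᵘ (ℤ.+ (a + b)) 0                  ≈⟨ mkℚᵘ-+ a b ⟨
  ℚᵘ.mkℚᵘ (ℤ.+ a) 0 ℚᵘ.+ ℚᵘ.mkℚᵘ (ℤ.+ b) 0 ≈⟨ UP.+-cong (toℚᵘ-ℕtoℚ a) (toℚᵘ-ℕtoℚ b) ⟨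
  ℚ.toℚᵘ (ℕtoℚ a) ℚᵘ.+ ℚ.toℚᵘ (ℕtoℚ b)     ≈⟨ QP.toℚᵘ-homo-+ (ℕtoℚ a) (ℕtoℚ b) ⟨
  ℚ.toℚᵘ (ℕtoℚ a ℚ.+ ℕtoℚ b)               ∎)
  where open UP.≃-Reasoning

ℕtoℚ-cancel-≤ : ∀ {a b} → ℕtoℚ a ℚ.≤ ℕtoℚ b → a ≤ b
ℕtoℚ-cancel-≤ {a} {b} a≤b
  with UP.≤-respʳ-≃ (toℚᵘ-ℕtoℚ b) (UP.≤-respˡ-≃ (toℚᵘ-ℕtoℚ a) (QP.toℚᵘ-mono-≤ a≤b))
... | ℚᵘ.*≤* a*1≤b*1 =
  ZP.drop‿+≤+ (subst₂ ℤ._≤_ (ZP.*-identityʳ (ℤ.+ a)) (ZP.*-identityʳ (ℤ.+ b)) a*1≤b*1)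

ℕtoℚ-nonNeg : ∀ n → 0ℚ ℚ.≤ ℕtoℚ n
ℕtoℚ-nonNeg n = QP.nonNegative⁻¹ (ℕtoℚ n) {{QP.normalize-nonNeg n 1}}

sumℚ-cong : ∀ {k} {f g : Fin k → ℚ} → f ≗ g → sumℚ f ≡ sumℚ g
sumℚ-cong {zero}  _   = refl
sumℚ-cong {suc k} f≗g = cong₂ ℚ._+_ (f≗g zero) (sumℚ-cong (f≗g ∘ suc))

sumℚ-ℕtoℚ : ∀ {k} (f : Fin k → ℕ) → sumℚ (ℕtoℚ ∘ f) ≡ ℕtoℚ (sum f)
sumℚ-ℕtoℚ {zero}  f = refl
sumℚ-ℕtoℚ {suc k} f = trans (cong (ℕtoℚ (f zero) ℚ.+_) (sumℚ-ℕtoℚ (f ∘ suc)))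
                            (sym (ℕtoℚ-+ (f zero) (sum (f ∘ suc))))

rank : ∀ {k} → (Fin k → Bool) → Fin k → ℕ
rank X zero    = 0
rank X (suc i) = indicator (X zero) + rank (X ∘ suc) i

rank<count : ∀ {k} (X : Fin k → Bool) x → X x ≡ true → rank X x < count X
rank<count X zero    Xx rewrite Xx = s≤s z≤n
rank<count X (suc x) Xx = NP.+-monoʳ-< (indicator (X zero)) (rank<count (X ∘ suc) x Xx)

rank-injective : ∀ {k} (X : Fin k → Bool) {x y} →
                 X x ≡ true → X y ≡ true → rank X x ≡ rank X y → x ≡ y
rank-injective X {zero}  {zero}  _  _  _ = refl
rank-injective X {zero}  {suc y} Xx _  r rewrite Xx with r
... | ()
rank-injective X {suc x} {zero}  _  Xy r rewrite Xy with r
... | ()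
rank-injective X {suc x} {suc y} Xx Xy r =
  cong suc (rank-injective (X ∘ suc) Xx Xy (NP.+-cancelˡ-≡ (indicator (X zero)) _ _ r))

module _ {A : Set} {R : A → A → Set} {P : A → Set} where

  Reach-start : ∀ {a b} → Reach R P a b → P a
  Reach-start (here Pa)     = Pa
  Reach-start (step Pa _ _) = Pa

  Reach-trans : ∀ {a b c} → Reach R P a b → Reach R P b c → Reach R P a c
  Reach-trans (here _)        r′ = r′
  Reach-trans (step Pa ab r) r′ = step Pa ab (Reach-trans r r′)

  Reach-sym : (∀ {x y} → R x y → R y x) → ∀ {a b} → Reach R P a b → Reach R P b a
  Reach-sym R-sym (here Pa)      = here Pa
  Reach-sym R-sym (step Pa ab r) = Reach-trans (Reach-sym R-sym r) (step (Reach-start r) (R-sym ab) (here Pa))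

Reach-map : ∀ {A B : Set} {R : A → A → Set} {P : A → Set} {R′ : B → B → Set} {P′ : B → Set}
            (f : A → B) → (∀ {x y} → R x y → R′ (f x) (f y)) → (∀ {x} → P x → P′ (f x)) →
            ∀ {a b} → Reach R P a b → Reach R′ P′ (f a) (f b)
Reach-map f f-R f-P (here Pa)      = here (f-P Pa)
Reach-map f f-R f-P (step Pa ab r) = step (f-P Pa) (f-R ab) (Reach-map f f-R f-P r)

TreeEdge-sym : ∀ {t} {T : Tree t} {a b} → TreeEdge T a b → TreeEdge T b a
TreeEdge-sym (inj₁ e) = inj₂ e
TreeEdge-sym (inj₂ e) = inj₁ e

reach-root : ∀ {t} (T : Tree (suc t)) {P : Fin (suc t) → Set} → (∀ c → P c) →
             ∀ a → Reach (TreeEdge T) P a zero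
reach-root T {P} P-all a = go (toℕ a) a NP.≤-refl
  where
  open Tree T
  go : ∀ n a → toℕ a ≤ n → Reach (TreeEdge T) P a zero
  go _       zero    _         = here (P-all zero)
  go (suc n) (suc p) (s≤s p≤n) = step (P-all (suc p)) (inj₂ ((λ ()) , refl))
    (go n (parent (suc p)) (NP.≤-trans (NP.≤-pred (parent-lt (suc p) (λ ()))) p≤n))

module ComponentLabelling (J : Graph) (S : Fin (size J) → Bool) where

  private
    V : Set
    V = Fin (size J)

  Open : V → Set
  Open z = S z ≡ false

  Linked : V → V → Set
  Linked x y = x ≡ y ⊎ Reach (E J) Open x y

  linked-trans : ∀ {x y z} → Linked x y → Linked y z → Linked x z
  linked-trans (inj₁ refl) yz          = yz
  linked-trans (inj₂ xy)   (inj₁ refl) = inj₂ xy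
  linked-trans (inj₂ xy)   (inj₂ yz)   = inj₂ (Reach-trans xy yz)

  Sound : (V → V) → Set
  Sound lab = ∀ x y → lab x ≡ lab y → Linked x y

  OpenEdge : V → V → Set
  OpenEdge a b = Open a × Open b × E J a b

  openEdge? : ∀ a b → Dec (OpenEdge a b)
  openEdge? a b = (S a Bool.≟ false) ×-dec ((S b Bool.≟ false) ×-dec E-dec J a b)

  merge : V → V → (V → V) → V → V
  merge a b lab z = if does (lab z ≟ lab b) then lab a else lab z

  merge-preserves-≡ : ∀ a b lab {x y} → lab x ≡ lab y → merge a b lab x ≡ merge a b lab y
  merge-preserves-≡ a b lab e = cong (λ l → if does (l ≟ lab b) then lab a else l) e

  merge-identifies : ∀ a b lab → merge a b lab a ≡ merge a b lab b
  merge-identifies a b lab rewrite dec-true (lab b ≟ lab b) refl = if-eta (does (lab a ≟ lab b))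

  merge-sound : ∀ {a b lab} → OpenEdge a b → Sound lab → Sound (merge a b lab)
  merge-sound {a} {b} {lab} (oa , ob , ab) sound x y e with lab x ≟ lab b | lab y ≟ lab b
  ... | yes x~b | yes y~b = sound x y (trans x~b (sym y~b))
  ... | yes x~b | no _    =
    linked-trans (sound x b x~b) (linked-trans (inj₂ (step ob (E-sym J ab) (here oa))) (sound a y e))
  ... | no _    | yes y~b =
    linked-trans (sound x a e) (linked-trans (inj₂ (step oa ab (here ob))) (sound b y (sym y~b)))
  ... | no _    | no _    = sound x y e

  mergeAll : List (V × V) → (V → V) → V → V
  mergeAll []             lab = lab
  mergeAll ((a , b) ∷ ps) lab with openEdge? a b
  ... | yes _ = mergeAll ps (merge a b lab)
  ... | no _  = mergeAll ps lab

  mergeAll-preserves-≡ : ∀ ps lab {x y} → lab x ≡ lab y → mergeAll ps lab x ≡ mergeAll ps lab y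
  mergeAll-preserves-≡ []             lab e = e
  mergeAll-preserves-≡ ((a , b) ∷ ps) lab e with openEdge? a b
  ... | yes _ = mergeAll-preserves-≡ ps (merge a b lab) (merge-preserves-≡ a b lab e)
  ... | no _  = mergeAll-preserves-≡ ps lab e

  mergeAll-sound : ∀ ps lab → Sound lab → Sound (mergeAll ps lab)
  mergeAll-sound []             lab sound = sound
  mergeAll-sound ((a , b) ∷ ps) lab sound with openEdge? a b
  ... | yes ab = mergeAll-sound ps (merge a b lab) (merge-sound ab sound)
  ... | no _   = mergeAll-sound ps lab sound

  mergeAll-identifies : ∀ ps lab {a b} → (a , b) ∈ ps → OpenEdge a b →
                        mergeAll ps lab a ≡ mergeAll ps lab b
  mergeAll-identifies ((a , b) ∷ ps) lab (here refl) ab with openEdge? a b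
  ... | yes _  = mergeAll-preserves-≡ ps (merge a b lab) (merge-identifies a b lab)
  ... | no ¬ab = ⊥-elim (¬ab ab)
  mergeAll-identifies ((c , d) ∷ ps) lab (there p) ab with openEdge? c d
  ... | yes _ = mergeAll-identifies ps (merge c d lab) p ab
  ... | no _  = mergeAll-identifies ps lab p ab

  pairs : List (V × V)
  pairs = cartesianProduct (allFin (size J)) (allFin (size J))

  label : V → V
  label = mergeAll pairs id

  label-sound : Sound label
  label-sound = mergeAll-sound pairs id (λ _ _ → inj₁)

  label-edge : ∀ {x y} → Open x → Open y → E J x y → label x ≡ label y
  label-edge {x} {y} ox oy e =
    mergeAll-identifies pairs id (∈-cartesianProduct⁺ (∈-allFin x) (∈-allFin y)) (ox , oy , e)

  inComponent : V → V → Bool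
  inComponent r z = does ((S z Bool.≟ false) ×-dec (label z ≟ r))

  inComponent-self : ∀ {x} → Open x → inComponent (label x) x ≡ true
  inComponent-self {x} ox = dec-true ((S x Bool.≟ false) ×-dec (label x ≟ label x)) (ox , refl)

  component-small : ∀ {m} → SmallComponents J S m → ∀ x → count (inComponent (label x)) ≤ m
  component-small small x = small x (inComponent (label x)) reach
    where
    reach : ∀ z → inComponent (label x) z ≡ true → Reach (E J) Open x z
    reach z z∈ with does-true⇒ ((S z Bool.≟ false) ×-dec (label z ≟ label x)) z∈
    ... | oz , same with label-sound x z (sym same)
    ... | inj₁ refl = here oz
    ... | inj₂ path = path

-- Vertex zero is the apex; suc (combine h j) is the vertex h of the j-th copy of H.
module ConeOfCopies (H : Graph) (k : ℕ) where

  Vertex : Set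
  Vertex = Fin (suc (size H ℕ.* k))

  splitVertex : Fin (size H ℕ.* k) → Fin (size H) × Fin k
  splitVertex = remQuot {size H} k

  copy : Fin (size H) → Fin k → Vertex
  copy h j = suc (combine h j)

  CopyEdge : Fin (size H) × Fin k → Fin (size H) × Fin k → Set
  CopyEdge (h , j) (h′ , j′) = j ≡ j′ × E H h h′

  Edge : Vertex → Vertex → Set
  Edge zero    zero    = ⊥
  Edge zero    (suc _) = ⊤
  Edge (suc _) zero    = ⊤
  Edge (suc p) (suc q) = CopyEdge (splitVertex p) (splitVertex q)

  Edge-dec : ∀ u v → Dec (Edge u v)
  Edge-dec zero    zero    = no λ ()
  Edge-dec zero    (suc _) = yes tt
  Edge-dec (suc _) zero    = yes tt
  Edge-dec (suc p) (suc q) = (proj₂ (splitVertex p) ≟ proj₂ (splitVertex q)) ×-dec E-dec H _ _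

  Edge-sym : ∀ {u v} → Edge u v → Edge v u
  Edge-sym {zero}  {suc _} _         = tt
  Edge-sym {suc _} {zero}  _         = tt
  Edge-sym {suc _} {suc _} (j≡j′ , e) = sym j≡j′ , E-sym H e

  Edge-irr : ∀ {u} → Edge u u → ⊥
  Edge-irr {suc _} (_ , e) = E-irr H e

  graph : Graph
  graph = record
    { size = suc (size H ℕ.* k) ; E = Edge ; E-dec = Edge-dec
    ; E-sym = λ {u} {v} → Edge-sym {u} {v} ; E-irr = λ {u} → Edge-irr {u} }

  copy-edge : ∀ {j j′} h h′ → j ≡ j′ → E H h h′ → Edge (copy h j) (copy h′ j′)
  copy-edge {j} {j′} h h′ j≡j′ e =
    subst₂ CopyEdge (sym (FP.remQuot-combine h j)) (sym (FP.remQuot-combine h′ j′)) (j≡j′ , e)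

  -- Node zero is a new root with bag {apex}; node suc (combine j i) is node i of the j-th copy of
  -- the tree, with the j-th copy of bag i plus the apex.
  module _ {w} (D : TreeDecomposition H w) where
    open TreeDecomposition D
    open Tree tree

    Node : Set
    Node = Fin (suc (k ℕ.* t))

    splitNode : Fin (k ℕ.* t) → Fin k × Fin t
    splitNode = remQuot {k} t

    node : Fin k → Fin t → Node
    node j i = suc (combine j i)

    parentOf : Fin k → Fin t → Node
    parentOf j i with toℕ i ℕ.≟ 0
    ... | yes _ = zero
    ... | no _  = node j (parent i)

    parent′ : Node → Node
    parent′ zero    = zero
    parent′ (suc p) = uncurry parentOf (splitNode p)

    parentOf-< : ∀ j i → toℕ (parentOf j i) < suc (toℕ (combine j i))
    parentOf-< j i with toℕ i ℕ.≟ 0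
    ... | yes _ = s≤s z≤n
    ... | no i≢0 rewrite FP.toℕ-combine j i | FP.toℕ-combine j (parent i) =
      s≤s (NP.+-monoʳ-< (t ℕ.* toℕ j) (parent-lt i i≢0))

    parent′-< : ∀ a → toℕ a ≢ 0 → toℕ (parent′ a) < toℕ a
    parent′-< zero    a≢0 = ⊥-elim (a≢0 refl)
    parent′-< (suc p) _   = subst (λ c → toℕ (parent′ (suc p)) < suc (toℕ c))
                                  (FP.combine-remQuot {k} t p)
                                  (parentOf-< (proj₁ (splitNode p)) (proj₂ (splitNode p)))

    tree′ : Tree (suc (k ℕ.* t))
    tree′ = record { parent = parent′ ; parent-lt = parent′-< }

    parent′-node : ∀ j i → toℕ i ≢ 0 → parent′ (node j i) ≡ node j (parent i)
    parent′-node j i i≢0 = trans (cong (uncurry parentOf) (FP.remQuot-combine j i)) parentOf-non-root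
      where
      parentOf-non-root : parentOf j i ≡ node j (parent i)
      parentOf-non-root with toℕ i ℕ.≟ 0
      ... | yes i≡0 = ⊥-elim (i≢0 i≡0)
      ... | no _    = refl

    node-edge : ∀ {j c c′} → TreeEdge tree c c′ → TreeEdge tree′ (node j c) (node j c′)
    node-edge {j} {c′ = c′} (inj₁ (c′≢0 , e)) =
      inj₁ ((λ ()) , trans (parent′-node j c′ c′≢0) (cong (node j) e))
    node-edge {j} {c}       (inj₂ (c≢0 , e))  =
      inj₂ ((λ ()) , trans (parent′-node j c c≢0) (cong (node j) e))

    node-splitNode : ∀ {j} p → proj₁ (splitNode p) ≡ j → node j (proj₂ (splitNode p)) ≡ suc p
    node-splitNode p refl = cong suc (FP.combine-remQuot {k} t p)

    inBag : Fin k × Fin t → Fin (size H) × Fin k → Bool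
    inBag (j , i) (h , j′) = does (j ≟ j′) ∧ bag i h

    bag′ : Node → Vertex → Bool
    bag′ _       zero    = true
    bag′ zero    (suc q) = false
    bag′ (suc p) (suc q) = inBag (splitNode p) (splitVertex q)

    bag′-node : ∀ i q → bag i (proj₁ (splitVertex q)) ≡ true →
                bag′ (node (proj₂ (splitVertex q)) i) (suc q) ≡ true
    bag′-node i q q∈i =
      subst (λ r → inBag r (splitVertex q) ≡ true) (sym (FP.remQuot-combine j i))
            (subst (λ b → b ∧ bag i (proj₁ (splitVertex q)) ≡ true) (sym (dec-true (j ≟ j) refl)) q∈i)
      where j = proj₂ (splitVertex q)

    bag′-inv : ∀ p q → bag′ (suc p) (suc q) ≡ true →
               proj₁ (splitNode p) ≡ proj₂ (splitVertex q) ×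
               bag (proj₂ (splitNode p)) (proj₁ (splitVertex q)) ≡ true
    bag′-inv p q q∈p with ∧-true q∈p
    ... | same-copy , q∈i = does-true⇒ (proj₁ (splitNode p) ≟ proj₂ (splitVertex q)) same-copy , q∈i

    cover-vertex′ : ∀ v → ∃ λ a → bag′ a v ≡ true
    cover-vertex′ zero    = zero , refl
    cover-vertex′ (suc q) with cover-vertex (proj₁ (splitVertex q))
    ... | i , q∈i = node (proj₂ (splitVertex q)) i , bag′-node i q q∈i

    cover-edge′ : ∀ u v → Edge u v → ∃ λ a → bag′ a u ≡ true × bag′ a v ≡ true
    cover-edge′ zero    (suc q) _ with cover-vertex′ (suc q)
    ... | a , q∈a = a , refl , q∈a
    cover-edge′ (suc q) zero    _ with cover-vertex′ (suc q)
    ... | a , q∈a = a , q∈a , refl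
    cover-edge′ (suc q) (suc q′) (j≡j′ , e) with cover-edge _ _ e
    ... | i , q∈i , q′∈i =
      node (proj₂ (splitVertex q)) i , bag′-node i q q∈i ,
      subst (λ j → bag′ (node j i) (suc q′) ≡ true) (sym j≡j′) (bag′-node i q′ q′∈i)

    connected′ : ∀ v a b → bag′ a v ≡ true → bag′ b v ≡ true →
                 Reach (TreeEdge tree′) (λ c → bag′ c v ≡ true) a b
    connected′ zero a b _ _ = Reach-trans (reach-root tree′ (λ _ → refl) a)
                                          (Reach-sym (TreeEdge-sym {T = tree′}) (reach-root tree′ (λ _ → refl) b))
    connected′ (suc q) (suc p) (suc p′) q∈p q∈p′ with bag′-inv p q q∈p | bag′-inv p′ q q∈p′
    ... | jp , ip | jp′ , ip′ =
      subst₂ (Reach (TreeEdge tree′) (λ c → bag′ c (suc q) ≡ true)) (node-splitNode p jp) (node-splitNode p′ jp′)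
        (Reach-map (node (proj₂ (splitVertex q))) node-edge (bag′-node _ q)
                   (connected (proj₁ (splitVertex q)) _ _ ip ip′))

    width′ : ∀ a → count (bag′ a) ≤ suc (suc w)
    width′ zero    rewrite count-false (size H ℕ.* k) = s≤s z≤n
    width′ (suc p) =
      s≤s (subst (_≤ suc w) (sym (count-column (bag (proj₂ (splitNode p))) (proj₁ (splitNode p))))
                 (width-≤ (proj₂ (splitNode p))))

    treeDecomposition : TreeDecomposition graph (suc w)
    treeDecomposition = record
      { t = suc (k ℕ.* t) ; tree = tree′ ; bag = bag′ ; cover-vertex = cover-vertex′
      ; cover-edge = cover-edge′ ; connected = connected′ ; width-≤ = width′ }

row : (H J : Graph) → Fin (size (H ⊠ J)) → Fin (size H)
row H J p = proj₁ (remQuot {size H} (size J) p)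

column : (H J : Graph) → Fin (size (H ⊠ J)) → Fin (size J)
column H J p = proj₂ (remQuot {size H} (size J) p)

row-column-injective : ∀ H J {p q} → row H J p ≡ row H J q → column H J p ≡ column H J q → p ≡ q
row-column-injective H J {p} {q} rp≡rq cp≡cq = begin
  p                                  ≡⟨ FP.combine-remQuot {size H} (size J) p ⟨
  combine (row H J p) (column H J p) ≡⟨ cong₂ combine rp≡rq cp≡cq ⟩
  combine (row H J q) (column H J q) ≡⟨ FP.combine-remQuot {size H} (size J) q ⟩
  q                                  ∎
  where open ≡-Reasoning

⊆-⊠K : ∀ {G A m} (F : Fin (size G) → Fin (size A) × Fin m) → Injective _≡_ _≡_ F →
       (∀ {u v} → E G u v → proj₁ (F u) ≢ proj₁ (F v) → E A (proj₁ (F u)) (proj₁ (F v))) →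
       G ⊆G (A ⊠ K m)
⊆-⊠K {G} {A} {m} F F-injective F-edge = uncurry combine ∘ F , injective , edge
  where
  remQuot-F : ∀ u → remQuot m (uncurry combine (F u)) ≡ F u
  remQuot-F u = FP.remQuot-combine (proj₁ (F u)) (proj₂ (F u))

  injective : Injective _≡_ _≡_ (uncurry combine ∘ F)
  injective {u} {v} e = F-injective (trans (sym (remQuot-F u)) (trans (cong (remQuot m) e) (remQuot-F v)))

  strong : ∀ u v → E G u v → SE A (K m) (F u) (F v)
  strong u v e with proj₁ (F u) ≟ proj₁ (F v) | proj₂ (F u) ≟ proj₂ (F v)
  ... | yes a≡ | yes i≡ = ⊥-elim (E-irr G (subst (E G u) (sym (F-injective (cong₂ _,_ a≡ i≡))) e))
  ... | yes a≡ | no i≢  = inj₁ (a≡ , i≢)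
  ... | no a≢  | yes i≡ = inj₂ (inj₁ (i≡ , F-edge e a≢))
  ... | no a≢  | no i≢  = inj₂ (inj₂ (F-edge e a≢ , i≢))

  edge : ∀ u v → E G u v → E (A ⊠ K m) (uncurry combine (F u)) (uncurry combine (F v))
  edge u v e = subst₂ (SE A (K m)) (sym (remQuot-F u)) (sym (remQuot-F v)) (strong u v e)

fibre-separator : ∀ {J n m k} → Separable J n m → (g : Fin k → Fin (size J)) → k ≡ n →
                  Σ (Fin (size J) → Bool) λ S → count (S ∘ g) ≤ m × SmallComponents J S m
fibre-separator {J} {n} {m} {k} separable g k≡n = S , few , proj₂ (proj₂ separation)
  where
  open ≡-Reasoning

  weight : Fin (size J) → ℚ
  weight = ℕtoℚ ∘ fibre g

  total : sumℚ weight ≡ ℕtoℚ n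
  total = begin
    sumℚ weight                   ≡⟨ sumℚ-ℕtoℚ (fibre g) ⟩
    ℕtoℚ (sum (fibre g))          ≡⟨ cong ℕtoℚ (count-∘ g (λ _ → true)) ⟨
    ℕtoℚ (count {k} (λ _ → true)) ≡⟨ cong ℕtoℚ (trans (count-true k) k≡n) ⟩
    ℕtoℚ n                        ∎

  separation : Σ (Fin (size J) → Bool) λ S →
               (sumℚ (λ x → if S x then weight x else 0ℚ) ℚ.≤ ℕtoℚ m) × SmallComponents J S m
  separation = separable weight (ℕtoℚ-nonNeg ∘ fibre g) total
  S : Fin (size J) → Bool
  S = proj₁ separation

  weight-S : sumℚ (λ x → if S x then weight x else 0ℚ) ≡ ℕtoℚ (count (S ∘ g))
  weight-S = begin
    sumℚ (λ x → if S x then weight x else 0ℚ)   ≡⟨ sumℚ-cong (λ x → if-float ℕtoℚ (S x)) ⟨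
    sumℚ (ℕtoℚ ∘ fibre-S)                       ≡⟨ sumℚ-ℕtoℚ fibre-S ⟩
    ℕtoℚ (sum fibre-S)                          ≡⟨ cong ℕtoℚ (count-∘ g S) ⟨
    ℕtoℚ (count (S ∘ g))                        ∎
    where
    fibre-S : Fin (size J) → ℕ
    fibre-S x = if S x then fibre g x else 0

  few : count (S ∘ g) ≤ m
  few = ℕtoℚ-cancel-≤ (subst (ℚ._≤ ℕtoℚ m) weight-S (proj₁ (proj₂ separation)))

module ConeEmbedding
  (H J G : Graph) (m : ℕ)
  (f : Fin (size G) → Fin (size (H ⊠ J))) (f-injective : Injective _≡_ _≡_ f)
  (f-edge : ∀ u v → E G u v → E (H ⊠ J) (f u) (f v))
  (S : Fin (size J) → Bool) (small : SmallComponents J S m)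
  (few : count (S ∘ column H J ∘ f) ≤ m) where

  open ComponentLabelling J S
  open ConeOfCopies H (size J) using (graph; copy; copy-edge; Edge)

  h : Fin (size G) → Fin (size H)
  h = row H J ∘ f

  g : Fin (size G) → Fin (size J)
  g = column H J ∘ f

  overS : Fin (size G) → Bool
  overS = S ∘ g

  place : ∀ u b → S (g u) ≡ b → Fin (size graph) × Fin m
  place u true  s = zero , fromℕ< (NP.<-≤-trans (rank<count overS u s) few)
  place u false s = copy (h u) (label (g u)) ,
    fromℕ< (NP.<-≤-trans (rank<count (inComponent (label (g u))) (g u) (inComponent-self s))
                         (component-small small (g u)))

  F : Fin (size G) → Fin (size graph) × Fin m
  F u = place u (S (g u)) refl

  data Placement (u : Fin (size G)) (p : Fin (size graph) × Fin m) : Set where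
    over-S : S (g u) ≡ true → proj₁ p ≡ zero → toℕ (proj₂ p) ≡ rank overS u → Placement u p
    off-S  : S (g u) ≡ false → proj₁ p ≡ copy (h u) (label (g u)) →
             toℕ (proj₂ p) ≡ rank (inComponent (label (g u))) (g u) → Placement u p

  placement : ∀ u → Placement u (F u)
  placement u = view (S (g u)) refl
    where
    view : ∀ b (s : S (g u) ≡ b) → Placement u (place u b s)
    view true  s = over-S s refl (FP.toℕ-fromℕ< _)
    view false s = off-S s refl (FP.toℕ-fromℕ< _)

  F-injective : Injective _≡_ _≡_ F
  F-injective {u} {v} e with placement u | placement v
  ... | over-S su _ ru | over-S sv _ rv =
    rank-injective overS {u} {v} su sv (trans (sym ru) (trans (cong (toℕ ∘ proj₂) e) rv))
  ... | over-S _ pu _ | off-S _ pv _  = ⊥-elim (FP.0≢1+n (trans (sym pu) (trans (cong proj₁ e) pv)))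
  ... | off-S _ pu _  | over-S _ pv _ = ⊥-elim (FP.0≢1+n (trans (sym pv) (trans (cong proj₁ (sym e)) pu)))
  ... | off-S su pu ru | off-S sv pv rv = f-injective (row-column-injective H J (proj₁ same-copy) gu≡gv)
    where
    open ≡-Reasoning
    same-copy : h u ≡ h v × label (g u) ≡ label (g v)
    same-copy = FP.combine-injective _ _ _ _ (FP.suc-injective (trans (sym pu) (trans (cong proj₁ e) pv)))

    gv∈ : inComponent (label (g u)) (g v) ≡ true
    gv∈ = subst (λ r → inComponent r (g v) ≡ true) (sym (proj₂ same-copy)) (inComponent-self sv)

    gu≡gv : g u ≡ g v
    gu≡gv = rank-injective (inComponent (label (g u))) {g u} {g v} (inComponent-self su) gv∈ (begin
      rank (inComponent (label (g u))) (g u) ≡⟨ ru ⟨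
      toℕ (proj₂ (F u))                      ≡⟨ cong (toℕ ∘ proj₂) e ⟩
      toℕ (proj₂ (F v))                      ≡⟨ rv ⟩
      rank (inComponent (label (g v))) (g v) ≡⟨ cong (λ r → rank (inComponent r) (g v)) (proj₂ same-copy) ⟨
      rank (inComponent (label (g u))) (g v) ∎)

  F-edge : ∀ {u v} → E G u v → proj₁ (F u) ≢ proj₁ (F v) → Edge (proj₁ (F u)) (proj₁ (F v))
  F-edge {u} {v} e ne with placement u | placement v
  ... | over-S _ pu _ | over-S _ pv _ = ⊥-elim (ne (trans pu (sym pv)))
  ... | over-S _ pu _ | off-S _ pv _  = subst₂ Edge (sym pu) (sym pv) tt
  ... | off-S _ pu _  | over-S _ pv _ = subst₂ Edge (sym pu) (sym pv) tt
  ... | off-S su pu _ | off-S sv pv _ =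
    subst₂ Edge (sym pu) (sym pv) (uncurry (copy-edge (h u) (h v)) (project (f-edge u v e)))
    where
    project : SE H J (h u , g u) (h v , g v) → label (g u) ≡ label (g v) × E H (h u) (h v)
    project (inj₁ (hu≡hv , gu~gv)) =
      ⊥-elim (ne (trans pu (trans (cong₂ copy hu≡hv (label-edge su sv gu~gv)) (sym pv))))
    project (inj₂ (inj₁ (gu≡gv , hu~hv))) = cong label gu≡gv , hu~hv
    project (inj₂ (inj₂ (hu~hv , gu~gv))) = label-edge su sv gu~gv , hu~hv

  embedding : G ⊆G (graph ⊠ K m)
  embedding = ⊆-⊠K {G} {graph} {m} F F-injective F-edge

lemma29 : (H J : Graph) (n m : ℕ) → Separable J n m →
          (G : Graph) → size G ≡ n → G ⊆G (H ⊠ J) →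
          Σ Graph (λ L → (G ⊆G (L ⊠ K m)) ×
                         ((w : ℕ) → TwAtMost H w → TwAtMost L (suc w)))
lemma29 H J n m separable G |G|≡n (f , f-injective , f-edge) =
  ConeOfCopies.graph H (size J) , embedding , λ w D → ConeOfCopies.treeDecomposition H (size J) D
  where
  separator : Σ (Fin (size J) → Bool) λ S →
              count (S ∘ column H J ∘ f) ≤ m × SmallComponents J S m
  separator = fibre-separator {J} {n} {m} separable (column H J ∘ f) |G|≡n

  embedding : G ⊆G (ConeOfCopies.graph H (size J) ⊠ K m)
  embedding = ConeEmbedding.embedding H J G m f f-injective f-edge
                (proj₁ separator) (proj₂ (proj₂ separator)) (proj₁ (proj₂ separator))
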